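{- Let $f=(f_n)_{n\ge1}$ be a sequence of nonzero integers such that $\gcd(f_m,f_n)\mid f_{m+n}$ for all $m,n\in\mathbb{Z}^+$. Then $f$ is binomid.
   Context: For integers $0\le k\le n$, $\left[{n\atop k}\right]_f=\dfrac{f_nf_{n-1}\cdots f_{n-k+1}}{f_kf_{k-1}\cdots f_1}$ (equal to $1$ for $k=0$). The sequence $f$ is binomid if every $\left[{n\atop k}\right]_f$ with $0\le k\le n$ is an integer. -}

module Defs where

open import Data.Nat using (ℕ; zero; suc; _≤_; _∸_; _+_)
open import Data.Integer using (ℤ; _*_; 1ℤ; 0ℤ)
open import Data.Integer.GCD using (gcd)
open import Data.Integer.Divisibility using (_∣_)
open import Data.Product using (∃)
open import Relation.Binary.PropositionalEquality using (_≡_; _≢_)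

-- A sequence (f_n)_{n ≥ 1} of integers is represented as f : ℕ → ℤ;
-- the value f 0 is irrelevant and never used below.

fallingProd : (ℕ → ℤ) → ℕ → ℕ → ℤ
fallingProd f n zero    = 1ℤ
fallingProd f n (suc k) = f (n ∸ k) * fallingProd f n k

seqFactorial : (ℕ → ℤ) → ℕ → ℤ
seqFactorial f k = fallingProd f k k

IsIntegerBinomial : (ℕ → ℤ) → ℕ → ℕ → Set
IsIntegerBinomial f n k = ∃ λ (q : ℤ) → q * seqFactorial f k ≡ fallingProd f n k

Binomid : (ℕ → ℤ) → Set
Binomid f = ∀ n k → k ≤ n → IsIntegerBinomial f n k

NonzeroSeq : (ℕ → ℤ) → Set
NonzeroSeq f = ∀ n → 1 ≤ n → f n ≢ 0ℤ

GcdDividesSum : (ℕ → ℤ) → Set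
GcdDividesSum f = ∀ m n → 1 ≤ m → 1 ≤ n → gcd (f m) (f n) ∣ f (m + n)

module Submission where

open import Defs
open import Data.Nat
  using (ℕ; zero; suc; _+_; _*_; _^_; _≤_; _<_; _∸_; _⊓_; z≤n; s≤s; NonZero; ≢-nonZero; ≢-nonZero⁻¹; nonTrivial⇒n>1)
open import Data.Nat.Properties
open import Algebra.Properties.CommutativeSemigroup +-commutativeSemigroup
  using () renaming (interchange to +-interchange)
open import Data.Nat.Divisibility
open import Data.Nat.GCD using (gcd; gcd[m,n]∣m; gcd[m,n]∣n; gcd[m,n]≢0; gcd-greatest)
open import Data.Nat.Primality using (Prime; euclidsLemma; prime⇒nonZero; prime⇒nonTrivial)
open import Data.Nat.Primality.Factorisation using (factorise)
open import Data.Nat.ListAction using (product)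
open import Data.List using ([]; _∷_)
open import Data.List.Relation.Unary.All using (_∷_)
open import Data.Integer using (ℤ; ∣_∣)
open import Data.Integer.Properties using (abs-*; ∣i∣≡0⇒i≡0)
import Data.Integer.Divisibility.Signed as Signed
open import Data.Product using (∃; _×_; _,_)
open import Function using (_∘_)
open import Data.Sum using (inj₁; inj₂; [_,_])
open import Data.Empty using (⊥-elim)
open import Relation.Nullary using (Dec; yes; no; ¬_)
open import Level using (0ℓ)
open import Relation.Unary using (Pred; Decidable)
open import Relation.Binary.PropositionalEquality
  using (_≡_; refl; sym; trans; cong; cong₂; subst; subst₂; module ≡-Reasoning)

-- Put g i = ∣ f i ∣. Then [n k]_f is an integer as soon as g 1 ⋯ g k divides
-- g (m + 1) ⋯ g (m + k) with m = n - k, which we check prime by prime on valuations.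
-- The p-adic valuation of a product is the sum over e of the number of factors divisible by
-- p ^ (1 + e). For every d the set {i ≥ 1 : d divides g i} is closed under addition by the gcd
-- hypothesis, and an additively closed set of positive integers meets any window of k
-- consecutive integers at least as often as it meets {1, …, k}.

private
  variable
    a b k m n p t x y v w : ℕ
    h h′ : ℕ → ℕ

windowSum : (ℕ → ℕ) → ℕ → ℕ → ℕ
windowSum h a zero    = 0
windowSum h a (suc k) = h (suc a) + windowSum h (suc a) k

windowProd : (ℕ → ℕ) → ℕ → ℕ → ℕ
windowProd g a zero    = 1
windowProd g a (suc k) = g (suc a) * windowProd g (suc a) k

windowSum-cong : (∀ i → h i ≡ h′ i) → ∀ a k → windowSum h a k ≡ windowSum h′ a k
windowSum-cong eq a zero    = refl
windowSum-cong eq a (suc k) = cong₂ _+_ (eq (suc a)) (windowSum-cong eq (suc a) k)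

windowSum-+ : ∀ a k → windowSum (λ i → h i + h′ i) a k ≡ windowSum h a k + windowSum h′ a k
windowSum-+ a zero = refl
windowSum-+ {h} {h′} a (suc k) = begin
  (h (suc a) + h′ (suc a)) + windowSum (λ i → h i + h′ i) (suc a) k
    ≡⟨ cong ((h (suc a) + h′ (suc a)) +_) (windowSum-+ (suc a) k) ⟩
  (h (suc a) + h′ (suc a)) + (windowSum h (suc a) k + windowSum h′ (suc a) k)
    ≡⟨ +-interchange (h (suc a)) (h′ (suc a)) _ _ ⟩
  (h (suc a) + windowSum h (suc a) k) + (h′ (suc a) + windowSum h′ (suc a) k)
    ∎
  where open ≡-Reasoning

windowSum-zero : ∀ a k → windowSum (λ _ → 0) a k ≡ 0
windowSum-zero a zero    = refl
windowSum-zero a (suc k) = windowSum-zero (suc a) k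

windowSum-monoʳ : ∀ a k → windowSum h a k ≤ windowSum h a (suc k)
windowSum-monoʳ a zero    = z≤n
windowSum-monoʳ {h} a (suc k) = +-monoʳ-≤ (h (suc a)) (windowSum-monoʳ (suc a) k)

windowSum-slide : h (suc a) ≡ 0 → ∀ k → windowSum h a k ≤ windowSum h (suc a) k
windowSum-slide {h} {a} h[a+1]≡0 k =
  subst (windowSum h a k ≤_) (cong (_+ windowSum h (suc a) k) h[a+1]≡0) (windowSum-monoʳ a k)

windowSum-shift : (∀ i → h i ≤ h (i + t)) → ∀ a k → windowSum h a k ≤ windowSum h (a + t) k
windowSum-shift le a zero    = z≤n
windowSum-shift le a (suc k) = +-mono-≤ (le (suc a)) (windowSum-shift le (suc a) k)

windowSum-⊓ : ∀ a k → windowSum h a k ≤ n → windowSum (λ i → n ⊓ h i) a k ≡ windowSum h a k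
windowSum-⊓ a zero    _  = refl
windowSum-⊓ {h} a (suc k) le = cong₂ _+_
  (m≥n⇒m⊓n≡n (≤-trans (m≤m+n (h (suc a)) _) le))
  (windowSum-⊓ (suc a) k (≤-trans (m≤n+m _ (h (suc a))) le))

windowProd-nonZero : ∀ {g} → (∀ i → NonZero (g (suc i))) → ∀ a k → NonZero (windowProd g a k)
windowProd-nonZero nz a zero    = _
windowProd-nonZero {g} nz a (suc k) =
  m*n≢0 (g (suc a)) _ {{nz a}} {{windowProd-nonZero nz (suc a) k}}

indicator : ∀ {A : Set} → Dec A → ℕ
indicator (yes _) = 1
indicator (no _)  = 0

indicator-mono : ∀ {A B : Set} → (A → B) → (A? : Dec A) (B? : Dec B) → indicator A? ≤ indicator B?
indicator-mono A⇒B (yes _) (yes _) = ≤-refl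
indicator-mono A⇒B (yes A) (no ¬B) = ⊥-elim (¬B (A⇒B A))
indicator-mono A⇒B (no _)  B?      = z≤n

count : ∀ {P : Pred ℕ 0ℓ} → Decidable P → ℕ → ℕ → ℕ
count P? = windowSum (λ i → indicator (P? i))

-- If m is in the set, i ↦ i + m maps [1, k] into the window; if not, sliding the window
-- from m - 1 to m loses nothing.
count-initial≤count : ∀ {P : Pred ℕ 0ℓ} (P? : Decidable P) → (∀ {i j} → P i → P j → P (i + j)) →
                      ∀ m k → count P? 0 k ≤ count P? m k
count-initial≤count P? closed zero    k = ≤-refl
count-initial≤count P? closed (suc t) k with P? (suc t)
... | yes Pt = windowSum-shift (λ i → indicator-mono (λ Pi → closed Pi Pt) (P? i) (P? (i + suc t))) 0 k
... | no ¬Pt = ≤-trans (count-initial≤count P? closed t k) (windowSum-slide (indicator-no ¬Pt) k)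
  where
  indicator-no : ∀ {A : Set} {A? : Dec A} → ¬ A → indicator A? ≡ 0
  indicator-no {A? = yes A} ¬A = ⊥-elim (¬A A)
  indicator-no {A? = no _}  ¬A = refl

suc⊓≡⊓+indicator : ∀ n x → suc n ⊓ x ≡ n ⊓ x + indicator (n <? x)
suc⊓≡⊓+indicator n x with n <? x
... | yes n<x = begin
  suc n ⊓ x  ≡⟨ m≤n⇒m⊓n≡m n<x ⟩
  suc n      ≡⟨ +-comm 1 n ⟩
  n + 1      ≡⟨ cong (_+ 1) (m≤n⇒m⊓n≡m (<⇒≤ n<x)) ⟨
  n ⊓ x + 1  ∎
  where open ≡-Reasoning
... | no n≮x = begin
  suc n ⊓ x  ≡⟨ m≥n⇒m⊓n≡n (≤-trans x≤n (n≤1+n n)) ⟩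
  x          ≡⟨ m≥n⇒m⊓n≡n x≤n ⟨
  n ⊓ x      ≡⟨ +-identityʳ (n ⊓ x) ⟨
  n ⊓ x + 0  ∎
  where
  open ≡-Reasoning
  x≤n = ≮⇒≥ n≮x

-- Layer-cake comparison: a sum of naturals is the sum over e of how many terms exceed e.
windowSum-≤-byLevels : (∀ e → count (λ i → e <? h i) a k ≤ count (λ i → e <? h′ i) b k) →
                       windowSum h a k ≤ windowSum h′ b k
windowSum-≤-byLevels {h} {a} {k} {h′} {b} levels = begin
  windowSum h a k                  ≡⟨ windowSum-⊓ a k (m≤m+n _ _) ⟨
  windowSum (λ i → N ⊓ h i) a k    ≤⟨ truncated N ⟩
  windowSum (λ i → N ⊓ h′ i) b k   ≡⟨ windowSum-⊓ b k (m≤n+m _ _) ⟩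
  windowSum h′ b k                 ∎
  where
  open ≤-Reasoning
  N = windowSum h a k + windowSum h′ b k

  truncated-suc : ∀ {h : ℕ → ℕ} a n → windowSum (λ i → suc n ⊓ h i) a k ≡
                  windowSum (λ i → n ⊓ h i) a k + count (λ i → n <? h i) a k
  truncated-suc {h} a n = trans
    (windowSum-cong {h′ = λ i → n ⊓ h i + indicator (n <? h i)} (λ i → suc⊓≡⊓+indicator n (h i)) a k)
    (windowSum-+ a k)

  truncated : ∀ n → windowSum (λ i → n ⊓ h i) a k ≤ windowSum (λ i → n ⊓ h′ i) b k
  truncated zero = ≤-reflexive (trans (windowSum-zero a k) (sym (windowSum-zero b k)))
  truncated (suc n) = begin
    windowSum (λ i → suc n ⊓ h i) a k                                 ≡⟨ truncated-suc a n ⟩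
    windowSum (λ i → n ⊓ h i) a k + count (λ i → n <? h i) a k        ≤⟨ +-mono-≤ (truncated n) (levels n) ⟩
    windowSum (λ i → n ⊓ h′ i) b k + count (λ i → n <? h′ i) b k      ≡⟨ truncated-suc b n ⟨
    windowSum (λ i → suc n ⊓ h′ i) b k                                ∎

maxBelow : ∀ {P : Pred ℕ 0ℓ} → Decidable P → ℕ → ℕ
maxBelow P? zero = 0
maxBelow P? (suc b) with P? (suc b)
... | yes _ = suc b
... | no _  = maxBelow P? b

maxBelow-holds : ∀ {P : Pred ℕ 0ℓ} (P? : Decidable P) → P 0 → ∀ b → P (maxBelow P? b)
maxBelow-holds P? P0 zero = P0
maxBelow-holds P? P0 (suc b) with P? (suc b)
... | yes Pb = Pb
... | no _   = maxBelow-holds P? P0 b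

maxBelow-greatest : ∀ {P : Pred ℕ 0ℓ} (P? : Decidable P) {e} b → e ≤ b → P e → e ≤ maxBelow P? b
maxBelow-greatest P? zero    e≤0 _ = e≤0
maxBelow-greatest P? {e} (suc b) e≤b+1 Pe with P? (suc b) | m≤n⇒m<n∨m≡n e≤b+1
... | yes _ | _           = e≤b+1
... | no _  | inj₁ e<b+1  = maxBelow-greatest P? b (≤-pred e<b+1) Pe
... | no ¬P | inj₂ refl   = ⊥-elim (¬P Pe)

n<m^n : 1 < m → ∀ n → n < m ^ n
n<m^n 1<m zero = s≤s z≤n
n<m^n {m} 1<m (suc n) = begin-strict
  suc n              <⟨ s≤s ih ⟩
  suc (m ^ n)        ≤⟨ +-monoˡ-≤ (m ^ n) (≤-trans (s≤s z≤n) ih) ⟩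
  m ^ n + m ^ n      ≡⟨ cong (m ^ n +_) (+-identityʳ (m ^ n)) ⟨
  2 * m ^ n          ≤⟨ *-monoˡ-≤ (m ^ n) 1<m ⟩
  m * m ^ n          ∎
  where
  open ≤-Reasoning
  ih = n<m^n 1<m n

^-monoʳ-∣ : ∀ p {e v} → e ≤ v → p ^ e ∣ p ^ v
^-monoʳ-∣ p {e} {v} e≤v = divides (p ^ (v ∸ e)) (begin
  p ^ v               ≡⟨ cong (p ^_) (m∸n+n≡m e≤v) ⟨
  p ^ (v ∸ e + e)     ≡⟨ ^-distribˡ-+-* p (v ∸ e) e ⟩
  p ^ (v ∸ e) * p ^ e ∎)
  where open ≡-Reasoning

record IsValuation (p x v : ℕ) : Set where
  field
    pow∣    : p ^ v ∣ x
    maximal : ∀ {e} → p ^ e ∣ x → e ≤ v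

open IsValuation

-- The bound x on the exponent is only correct for x ≠ 0 (then e < p ^ e ≤ x).
valuation : ℕ → ℕ → ℕ
valuation p x = maxBelow (λ e → p ^ e ∣? x) x

valuation-isValuation : 1 < p → .{{NonZero x}} → IsValuation p x (valuation p x)
valuation-isValuation {p} {x} 1<p = record
  { pow∣    = maxBelow-holds (λ e → p ^ e ∣? x) (1∣ x) x
  ; maximal = λ {e} p^e∣x →
      maxBelow-greatest (λ e → p ^ e ∣? x) x (<⇒≤ (<-≤-trans (n<m^n 1<p e) (∣⇒≤ p^e∣x))) p^e∣x
  }

IsValuation-1 : 1 < p → IsValuation p 1 0
IsValuation-1 1<p = record
  { pow∣    = ∣-refl
  ; maximal = λ {e} p^e∣1 → ≤-pred (<-≤-trans (n<m^n 1<p e) (∣⇒≤ p^e∣1))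
  }

IsValuation⇒∣ : ∀ {e} → IsValuation p x v → e ≤ v → p ^ e ∣ x
IsValuation⇒∣ {p} val e≤v = ∣-trans (^-monoʳ-∣ p e≤v) (pow∣ val)

IsValuation-cofactor : IsValuation p x v → ∃ λ c → x ≡ c * p ^ v × ¬ p ∣ c
IsValuation-cofactor {p} {x} {v} val with pow∣ val
... | divides c x≡c*p^v = c , x≡c*p^v , p∤c
  where
  p∤c : ¬ p ∣ c
  p∤c (divides r c≡r*p) = 1+n≰n (maximal val (divides r (begin
    x                ≡⟨ x≡c*p^v ⟩
    c * p ^ v        ≡⟨ cong (_* p ^ v) c≡r*p ⟩
    r * p * p ^ v    ≡⟨ *-assoc r p (p ^ v) ⟩
    r * (p * p ^ v)  ∎)))
    where open ≡-Reasoning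

IsValuation-* : Prime p → IsValuation p x v → IsValuation p y w → IsValuation p (x * y) (v + w)
IsValuation-* {p} {x} {v} {y} {w} p-prime val-x val-y
  with IsValuation-cofactor val-x | IsValuation-cofactor val-y
... | c , x≡c*p^v , p∤c | d , y≡d*p^w , p∤d = record
  { pow∣    = subst (_∣ x * y) (sym (^-distribˡ-+-* p v w)) (*-pres-∣ (pow∣ val-x) (pow∣ val-y))
  ; maximal = λ p^e∣xy → ≮⇒≥ λ v+w<e → p∤cd (p∣cd (∣-trans (^-monoʳ-∣ p v+w<e) p^e∣xy))
  }
  where
  instance _ = m^n≢0 p (v + w) {{prime⇒nonZero p-prime}}
  xy≡cd*p^[v+w] : x * y ≡ c * d * p ^ (v + w)
  xy≡cd*p^[v+w] = begin
    x * y                        ≡⟨ cong₂ _*_ x≡c*p^v y≡d*p^w ⟩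
    (c * p ^ v) * (d * p ^ w)    ≡⟨ [m*n]*[o*p]≡[m*o]*[n*p] c (p ^ v) d (p ^ w) ⟩
    (c * d) * (p ^ v * p ^ w)    ≡⟨ cong (c * d *_) (^-distribˡ-+-* p v w) ⟨
    c * d * p ^ (v + w)          ∎
    where open ≡-Reasoning
  p∣cd : p ^ suc (v + w) ∣ x * y → p ∣ c * d
  p∣cd = *-cancelʳ-∣ (p ^ (v + w)) ∘ subst (p * p ^ (v + w) ∣_) xy≡cd*p^[v+w]
  p∤cd : ¬ p ∣ c * d
  p∤cd p∣cd = [ p∤c , p∤d ] (euclidsLemma c d p-prime p∣cd)

prime⇒1< : Prime p → 1 < p
prime⇒1< {p} p-prime = nonTrivial⇒n>1 p {{prime⇒nonTrivial p-prime}}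

∃-prime-∣ : 1 < n → ∃ λ p → Prime p × p ∣ n
∃-prime-∣ {n@(suc _)} 1<n with factorise n
... | record { factors = [] ; isFactorisation = n≡1 } = ⊥-elim (<-irrefl (sym n≡1) 1<n)
... | record { factors = p ∷ ps ; isFactorisation = n≡p*ps ; factorsPrime = p-prime ∷ _ } =
  p , p-prime , divides (product ps) (trans n≡p*ps (*-comm p (product ps)))

-- Write b = q · gcd b a. A prime r ∣ q would make r ^ (1 + valuation r (gcd b a)) divide b,
-- hence a, hence gcd b a.
∣-byPrimePowers : .{{NonZero a}} → .{{NonZero b}} →
                  (∀ {p e} → Prime p → p ^ e ∣ b → p ^ e ∣ a) → b ∣ a
∣-byPrimePowers {a} {b} primePowers with gcd[m,n]∣m b a
... | divides zero b≡0 = ⊥-elim (≢-nonZero⁻¹ b b≡0)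
... | divides 1 b≡1*G = subst (_∣ a) (sym (trans b≡1*G (*-identityˡ (gcd b a)))) (gcd[m,n]∣n b a)
... | divides q@(suc (suc _)) b≡q*G with ∃-prime-∣ {q} (s≤s (s≤s z≤n))
...   | r , r-prime , r∣q = ⊥-elim (1+n≰n (maximal val-G r^[1+vG]∣G))
  where
  G = gcd b a
  vG = valuation r G
  val-G : IsValuation r G vG
  val-G = valuation-isValuation (prime⇒1< r-prime) {{≢-nonZero (gcd[m,n]≢0 b a (inj₁ (≢-nonZero⁻¹ b)))}}
  r^[1+vG]∣b : r ^ suc vG ∣ b
  r^[1+vG]∣b = subst (r ^ suc vG ∣_) (sym b≡q*G) (*-pres-∣ r∣q (pow∣ val-G))
  r^[1+vG]∣G : r ^ suc vG ∣ G
  r^[1+vG]∣G = gcd-greatest r^[1+vG]∣b (primePowers {e = suc vG} r-prime r^[1+vG]∣b)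

windowProd-isValuation : ∀ {g} → Prime p → (∀ i → NonZero (g (suc i))) → ∀ a k →
                         IsValuation p (windowProd g a k) (windowSum (λ i → valuation p (g i)) a k)
windowProd-isValuation p-prime g≢0 a zero    = IsValuation-1 (prime⇒1< p-prime)
windowProd-isValuation p-prime g≢0 a (suc k) = IsValuation-*
  p-prime
  (valuation-isValuation (prime⇒1< p-prime) {{g≢0 a}})
  (windowProd-isValuation p-prime g≢0 (suc a) k)

module _ (g : ℕ → ℕ) (g≢0 : ∀ i → NonZero (g (suc i)))
         (gcd-closed : ∀ {d m n} → d ∣ g (suc m) → d ∣ g (suc n) → d ∣ g (suc m + suc n)) where

  -- e < valuation p (g i) means p ^ (1 + e) ∣ g i: this is the gcd hypothesis at d = p ^ (1 + e).
  level-closed : ∀ {p} → Prime p → ∀ e {i j} → e < valuation p (g i) → e < valuation p (g j) →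
                 e < valuation p (g (i + j))
  level-closed p-prime e {zero}  _  e<vj = e<vj
  level-closed {p} p-prime e {i} {zero} e<vi _ =
    subst (λ i → e < valuation p (g i)) (sym (+-identityʳ i)) e<vi
  level-closed {p} p-prime e {suc i} {suc j} e<vi e<vj =
    maximal (val (i + suc j)) (gcd-closed (IsValuation⇒∣ (val i) e<vi) (IsValuation⇒∣ (val j) e<vj))
    where
    val : ∀ i → IsValuation p (g (suc i)) (valuation p (g (suc i)))
    val i = valuation-isValuation (prime⇒1< p-prime) {{g≢0 i}}

  valuations-initial≤ : ∀ {p} → Prime p → ∀ m k →
                        windowSum (λ i → valuation p (g i)) 0 k ≤ windowSum (λ i → valuation p (g i)) m k
  valuations-initial≤ {p} p-prime m k = windowSum-≤-byLevels {h = ν} {a = 0} {k = k} {h′ = ν} {b = m} λ l →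
    count-initial≤count (λ i → l <? ν i) (level-closed p-prime l) m k
    where
    ν : ℕ → ℕ
    ν i = valuation p (g i)

  windowProd-initial-∣ : ∀ m k → windowProd g 0 k ∣ windowProd g m k
  windowProd-initial-∣ m k =
    ∣-byPrimePowers {{windowProd-nonZero g≢0 m k}} {{windowProd-nonZero g≢0 0 k}} λ {p} {e} p-prime p^e∣B →
      IsValuation⇒∣ {e = e} (val p-prime m)
        (≤-trans (maximal (val p-prime 0) p^e∣B) (valuations-initial≤ p-prime m k))
    where
    val : ∀ {p} → Prime p → ∀ a → IsValuation p (windowProd g a k) (windowSum (λ i → valuation p (g i)) a k)
    val p-prime a = windowProd-isValuation p-prime g≢0 a k

∣fallingProd∣ : ∀ f m k → ∣ fallingProd f (m + k) k ∣ ≡ windowProd (λ i → ∣ f i ∣) m k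
∣fallingProd∣ f m zero = refl
∣fallingProd∣ f m (suc k) rewrite +-suc m k = trans
  (abs-* (f (suc m + k ∸ k)) (fallingProd f (suc m + k) k))
  (cong₂ _*_ (cong (λ i → ∣ f i ∣) (m+n∸n≡m (suc m) k)) (∣fallingProd∣ f (suc m) k))

proposition4p5 : (f : ℕ → ℤ) → NonzeroSeq f → GcdDividesSum f → Binomid f
proposition4p5 f f≢0 gcd∣f n k k≤n =
  subst (λ n → IsIntegerBinomial f n k) (m∸n+n≡m k≤n) (integral (n ∸ k))
  where
  g : ℕ → ℕ
  g i = ∣ f i ∣

  g≢0 : ∀ i → NonZero (g (suc i))
  g≢0 i = ≢-nonZero (f≢0 (suc i) (s≤s z≤n) ∘ ∣i∣≡0⇒i≡0)

  gcd-closed : ∀ {d m n} → d ∣ g (suc m) → d ∣ g (suc n) → d ∣ g (suc m + suc n)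
  gcd-closed {m = m} {n} d∣gm d∣gn =
    ∣-trans (gcd-greatest d∣gm d∣gn) (gcd∣f (suc m) (suc n) (s≤s z≤n) (s≤s z≤n))

  integral : ∀ m → IsIntegerBinomial f (m + k) k
  integral m with Signed.∣ᵤ⇒∣ (subst₂ _∣_ (sym (∣fallingProd∣ f 0 k)) (sym (∣fallingProd∣ f m k))
                                          (windowProd-initial-∣ g g≢0 gcd-closed m k))
  ... | Signed.divides q eq = q , sym eq
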